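{- For every irreducible $P\in\mathbb{F}_q[t]$ with $\deg P\ge2$ and every integer $e\ge3$, $$\delta(S(P^e))<\frac{\delta(P^e)}{q^{\deg P}}.$$
   Context: Let $\mathbb{F}_q$ be a finite field with $q$ elements ($q$ a prime power). Fix an enumeration $\mathbb{F}_q=\{a_0,a_1,\dots,a_{q-1}\}$ with $a_0=0$, $a_1=1$. Every nonzero $f\in\mathbb{F}_q[t]$ of degree $m$ is uniquely written $f=a_{i_0}+a_{i_1}t+\dots+a_{i_m}t^m$ with $0\le i_j\le q-1$, $a_{i_m}\neq 0$. Put $\delta(f)=i_0+i_1q+\dots+i_mq^m$ and $\delta(0)=0$. Order $\mathbb{F}_q[t]$ by: $f>g$ iff $\delta(f)>\delta(g)$. For nonzero $f$, $f!=\prod_{g<f}(f-g)$ (product over all $g\in\mathbb{F}_q[t]$ with $g<f$), and $0!=1$. For nonzero $f$, $S(f)$ is the smallest $g$ (in this order) with $f\mid g!$; $S(0)=0$. -}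

module Defs where

open import Data.Nat as ℕ using (ℕ; zero; suc; _+_; _*_; _∸_; _<_; _≤_; NonZero)
open import Data.Nat.DivMod using (_%_; _/_; m%n<n)
open import Data.Fin as Fin using (Fin; toℕ; fromℕ<)
open import Data.Fin.Properties using () renaming (_≟_ to _≟ᶠ_)
open import Data.List using (List; []; _∷_; length; map; foldr; upTo)
open import Data.Product using (Σ; ∃; _×_; _,_)
open import Data.Sum using (_⊎_)
open import Relation.Binary.PropositionalEquality using (_≡_; _≢_)
open import Relation.Nullary using (¬_; yes; no)
open import Algebra.Structures using (IsCommutativeRing)

-- A finite field F_q together with an enumeration F_q = {a_0,...,a_{q-1}}.
-- We take the carrier to be Fin q and the enumeration to be a_i = the
-- element i of Fin q (i.e. toℕ a_i ≡ i).  Any finite field with an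
-- enumeration is isomorphic to such a structure via i ↦ a_i.
-- The conditions a_0 = 0, a_1 = 1 are toℕ 0# ≡ 0 and toℕ 1# ≡ 1.

record FiniteField : Set where
  field
    q        : ℕ
    _+F_     : Fin q → Fin q → Fin q
    _*F_     : Fin q → Fin q → Fin q
    -F_      : Fin q → Fin q
    0F       : Fin q
    1F       : Fin q
    isCommutativeRing : IsCommutativeRing _≡_ _+F_ _*F_ -F_ 0F 1F
    0≢1      : 0F ≢ 1F
    inverse  : ∀ x → x ≢ 0F → ∃ λ y → x *F y ≡ 1F
    a₀≡0     : toℕ 0F ≡ 0
    a₁≡1     : toℕ 1F ≡ 1

-- Polynomials over F_q: coefficient lists, lowest degree first
-- (c₀ ∷ c₁ ∷ … represents c₀ + c₁ t + …).  Trailing zeros are allowed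
-- in the raw representation; two lists denote the same polynomial iff
-- they have the same normal form (trailing zeros stripped).

module Poly (F : FiniteField) where
  open FiniteField F
  open FiniteField F public using () renaming (q to card)

  Pol : Set
  Pol = List (Fin q)

  norm : Pol → Pol
  norm [] = []
  norm (c ∷ cs) with norm cs
  ... | d ∷ ds = c ∷ d ∷ ds
  ... | [] with c ≟ᶠ 0F
  ...   | yes _ = []
  ...   | no _  = c ∷ []

  _≈_ : Pol → Pol → Set
  f ≈ g = norm f ≡ norm g

  -- degree (the zero polynomial gets 0; it never matters below)
  deg : Pol → ℕ
  deg f = length (norm f) ∸ 1

  0P : Pol
  0P = []

  1P : Pol
  1P = 1F ∷ []

  _+P_ : Pol → Pol → Pol
  [] +P g = g
  (c ∷ cs) +P [] = c ∷ cs
  (c ∷ cs) +P (d ∷ ds) = (c +F d) ∷ (cs +P ds)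

  -P_ : Pol → Pol
  -P f = map -F_ f

  _-P_ : Pol → Pol → Pol
  f -P g = f +P (-P g)

  scale : Fin q → Pol → Pol
  scale c g = map (c *F_) g

  _*P_ : Pol → Pol → Pol
  [] *P g = []
  (c ∷ cs) *P g = scale c g +P (0F ∷ (cs *P g))

  _^P_ : Pol → ℕ → Pol
  f ^P zero = 1P
  f ^P suc n = f *P (f ^P n)

  prodP : List Pol → Pol
  prodP = foldr _*P_ 1P

  -- δ(a_{i₀} + a_{i₁} t + …) = i₀ + i₁ q + …   (trailing zeros contribute 0
  -- since toℕ 0F ≡ 0, so δ respects _≈_)
  δ : Pol → ℕ
  δ [] = 0
  δ (c ∷ cs) = toℕ c + q * δ cs

  _∣P_ : Pol → Pol → Set
  f ∣P g = ∃ λ h → (f *P h) ≈ g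

  Irreducible : Pol → Set
  Irreducible P = (1 ≤ deg P) × (∀ a b → P ≈ (a *P b) → deg a ≡ 0 ⊎ deg b ≡ 0)

  -- inverse of δ: the polynomial whose base-q digit i_j gives coefficient a_{i_j}
  module _ {{_ : NonZero q}} where
    digits : ℕ → ℕ → Pol       -- first argument is fuel
    digits zero    n = []
    digits (suc k) zero = []
    digits (suc k) n@(suc _) = fromℕ< (m%n<n n q) ∷ digits k (n / q)

  -- q ≥ 2 for a field (0F ≢ 1F); we supply the NonZero instance from 0F
  private
    q-nonZero : NonZero q
    q-nonZero with q | 0F
    ... | suc _ | _ = _

  fromδ : ℕ → Pol
  fromδ n = digits {{q-nonZero}} n n

  -- f! = ∏_{g < f} (f - g), where g ranges over all polynomials with δ g < δ f
  -- (the polynomials g < f are exactly fromδ k for k < δ f)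
  _! : Pol → Pol
  f ! = prodP (map (λ k → f -P fromδ k) (upTo (δ f)))

  -- g is S(f): the smallest polynomial (w.r.t. δ) with f ∣ g!
  IsS : Pol → Pol → Set
  IsS f g = (f ∣P (g !)) × (∀ h → δ h < δ g → ¬ (f ∣P (h !)))

module Submission where

-- Write Q = q ^ deg P.  The exponent of P in h! satisfies a Legendre formula
--   v_P(h!) = Σ_{j ≥ 1} ⌊δ(h) / Q^j⌋.
-- Indeed v_P is additive by Euclid's lemma, so v_P(h!) = Σ_j #{g < h : P^j ∣ h - g}; and the
-- polynomials g < h whose δ share the quotient by Q^j form blocks, each a complete residue
-- system modulo P^j (they differ only in the coefficients of degree < j · deg P), while the
-- incomplete last block misses the residue of h, which h itself would take.  The term j = 1
-- alone gives P^e ∣ h! for δ(h) = e Q, so δ(S(P^e)) ≤ e Q, and then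
--   δ(S(P^e)) · Q ≤ e Q² < Q^e ≤ δ(P^e)   for Q ≥ 4 and e ≥ 3.

open import Defs
open import Data.Nat using (ℕ; _*_; _^_; _≤_; _<_)
open import Data.Product using (∃; _×_)

open import Level using (0ℓ)
open import Data.Nat using (zero; suc; _+_; _∸_; z≤n; s≤s; NonZero; >-nonZero)
import Data.Nat.Properties as ℕₚ
open import Data.Nat.DivMod using (_%_; _/_; m%n<n; m/n<m; m≡m%n+[m/n]*n; m<n⇒m%n≡m; [m+kn]%n≡m%n; m<n⇒m/n≡0; m*n/n≡m)
open import Data.Nat.Solver using (module +-*-Solver)
open import Data.Nat.Induction using (<-wellFounded)
open import Induction.WellFounded using (Acc; acc)
open import Data.Fin using (Fin; toℕ; fromℕ<)
import Data.Fin.Properties as Finₚ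
open import Data.List using ([]; _∷_; length; applyUpTo)
open import Data.List.Properties using (map-upTo)
open import Data.Product using (_,_; proj₁; proj₂)
open import Data.Sum using (_⊎_; inj₁; inj₂; [_,_]′)
open import Data.Empty using (⊥; ⊥-elim)
open import Function using (case_of_)
open import Relation.Nullary using (¬_; Dec; yes; no)
open import Relation.Binary.PropositionalEquality
open import Relation.Binary.Bundles using (Setoid)
open import Algebra.Bundles using (CommutativeRing)
import Algebra.Properties.CommutativeSemigroup as CommSemigroupProperties
import Algebra.Properties.Ring as RingProperties
import Relation.Binary.Reasoning.Setoid as SetoidReasoning

digit-injective : ∀ {n a b x y} .{{_ : NonZero n}} → a < n → b < n → a + n * x ≡ b + n * y → a ≡ b × x ≡ y
digit-injective {n} {a} {b} {x} {y} a<n b<n eq =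
  a≡b , ℕₚ.*-cancelˡ-≡ x y n (ℕₚ.+-cancelˡ-≡ a _ _ (trans eq (cong (_+ n * y) (sym a≡b))))
  where
  open ≡-Reasoning
  a≡b : a ≡ b
  a≡b = begin
    a                  ≡⟨ m<n⇒m%n≡m a<n ⟨
    a % n              ≡⟨ [m+kn]%n≡m%n a x n ⟨
    (a + x * n) % n    ≡⟨ cong (_% n) (trans (cong (a +_) (ℕₚ.*-comm x n)) (trans eq (cong (b +_) (ℕₚ.*-comm n y)))) ⟩
    (b + y * n) % n    ≡⟨ [m+kn]%n≡m%n b y n ⟩
    b % n              ≡⟨ m<n⇒m%n≡m b<n ⟩
    b                  ∎

n<m^n : ∀ {m} n → 2 ≤ m → n < m ^ n
n<m^n zero    _   = s≤s z≤n
n<m^n {m@(suc _)} (suc n) 2≤m = begin-strict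
  suc n            <⟨ s≤s (n<m^n n 2≤m) ⟩
  suc (m ^ n)      ≤⟨ ℕₚ.+-monoʳ-≤ 1 (ℕₚ.m≤m+n (m ^ n) 0) ⟩
  1 + (m ^ n + 0)  ≤⟨ ℕₚ.+-monoˡ-≤ (m ^ n + 0) (ℕₚ.m^n>0 m n) ⟩
  2 * m ^ n        ≤⟨ ℕₚ.*-monoˡ-≤ (m ^ n) 2≤m ⟩
  m ^ suc n        ∎
  where open ℕₚ.≤-Reasoning

m*n²<n^m : ∀ {m n} → 3 ≤ m → 4 ≤ n → m * (n * n) < n ^ m
m*n²<n^m {m} {n} 3≤m 4≤n = subst (λ m → m * (n * n) < n ^ m) (ℕₚ.m+[n∸m]≡n 3≤m) (go (m ∸ 3))
  where
  open ℕₚ.≤-Reasoning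
  instance
    n-nonZero : NonZero n
    n-nonZero = >-nonZero (ℕₚ.≤-trans (s≤s z≤n) 4≤n)
  go : ∀ k → (3 + k) * (n * n) < n ^ (3 + k)
  go zero    = begin-strict
    3 * (n * n)                 <⟨ ℕₚ.*-monoˡ-< (n * n) {{ℕₚ.m*n≢0 n n}} 4≤n ⟩
    n * (n * n)                 ≡⟨ cong (λ x → n * (n * x)) (ℕₚ.*-identityʳ n) ⟨
    n ^ 3                       ∎
  go (suc k) = begin-strict
    n * n + (3 + k) * (n * n)   <⟨ ℕₚ.+-mono-< (ℕₚ.≤-<-trans (ℕₚ.m≤n*m (n * n) (3 + k)) (go k)) (go k) ⟩
    n ^ (3 + k) + n ^ (3 + k)   ≡⟨ cong (n ^ (3 + k) +_) (ℕₚ.+-identityʳ _) ⟨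
    2 * n ^ (3 + k)             ≤⟨ ℕₚ.*-monoˡ-≤ (n ^ (3 + k)) (ℕₚ.≤-trans (s≤s (s≤s z≤n)) 4≤n) ⟩
    n ^ (4 + k)                 ∎

∑< : (ℕ → ℕ) → ℕ → ℕ
∑< f zero    = 0
∑< f (suc n) = ∑< f n + f n

∑<-cong : ∀ {f g} n → (∀ i → i < n → f i ≡ g i) → ∑< f n ≡ ∑< g n
∑<-cong zero    f≗g = refl
∑<-cong (suc n) f≗g = cong₂ _+_ (∑<-cong n (λ i i<n → f≗g i (ℕₚ.m<n⇒m<1+n i<n))) (f≗g n ℕₚ.≤-refl)

∑<-const : ∀ c n → ∑< (λ _ → c) n ≡ n * c
∑<-const c zero    = refl
∑<-const c (suc n) = trans (cong (_+ c) (∑<-const c n)) (ℕₚ.+-comm (n * c) c)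

∑<-distrib-+ : ∀ f g n → ∑< (λ i → f i + g i) n ≡ ∑< f n + ∑< g n
∑<-distrib-+ f g zero    = refl
∑<-distrib-+ f g (suc n) = trans (cong (_+ (f n + g n)) (∑<-distrib-+ f g n))
  (solve 4 (λ a b c d → (a :+ b) :+ (c :+ d) := (a :+ c) :+ (b :+ d)) refl (∑< f n) (∑< g n) (f n) (g n))
  where open +-*-Solver

∑<-+ : ∀ f m n → ∑< f (m + n) ≡ ∑< f m + ∑< (λ i → f (m + i)) n
∑<-+ f m zero    = trans (cong (∑< f) (ℕₚ.+-identityʳ m)) (sym (ℕₚ.+-identityʳ _))
∑<-+ f m (suc n) = begin
  ∑< f (m + suc n)                                   ≡⟨ cong (∑< f) (ℕₚ.+-suc m n) ⟩
  ∑< f (m + n) + f (m + n)                           ≡⟨ cong (_+ f (m + n)) (∑<-+ f m n) ⟩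
  ∑< f m + ∑< (λ i → f (m + i)) n + f (m + n)        ≡⟨ ℕₚ.+-assoc (∑< f m) _ _ ⟩
  ∑< f m + ∑< (λ i → f (m + i)) (suc n)              ∎
  where open ≡-Reasoning

∑<-suc : ∀ f n → ∑< f (suc n) ≡ f 0 + ∑< (λ i → f (suc i)) n
∑<-suc f = ∑<-+ f 1

f0≤∑< : ∀ f {n} → 0 < n → f 0 ≤ ∑< f n
f0≤∑< f {suc n} _ = subst (f 0 ≤_) (sym (∑<-suc f n)) (ℕₚ.m≤m+n (f 0) _)

∑<-comm : ∀ (f : ℕ → ℕ → ℕ) m n → ∑< (λ i → ∑< (f i) n) m ≡ ∑< (λ j → ∑< (λ i → f i j) m) n
∑<-comm f zero    n = sym (trans (∑<-const 0 n) (ℕₚ.*-zeroʳ n))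
∑<-comm f (suc m) n = trans (cong (_+ ∑< (f m) n) (∑<-comm f m n))
                            (sym (∑<-distrib-+ (λ j → ∑< (λ i → f i j) m) (f m) n))

∑<-blocks : ∀ f b L → ∑< f (b * L) ≡ ∑< (λ c → ∑< (λ i → f (c * L + i)) L) b
∑<-blocks f zero    L = refl
∑<-blocks f (suc b) L = begin
  ∑< f (L + b * L)                                  ≡⟨ cong (∑< f) (ℕₚ.+-comm L (b * L)) ⟩
  ∑< f (b * L + L)                                  ≡⟨ ∑<-+ f (b * L) L ⟩
  ∑< f (b * L) + ∑< (λ i → f (b * L + i)) L         ≡⟨ cong (_+ ∑< (λ i → f (b * L + i)) L) (∑<-blocks f b L) ⟩
  ∑< (λ c → ∑< (λ i → f (c * L + i)) L) (suc b)     ∎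
  where open ≡-Reasoning

indicator : ∀ {A : Set} → Dec A → ℕ
indicator (yes _) = 1
indicator (no  _) = 0

module Counting {A : ℕ → Set} (A? : ∀ i → Dec (A i)) where

  count : ℕ → ℕ
  count = ∑< (λ i → indicator (A? i))

  count-none : ∀ n → (∀ i → i < n → ¬ A i) → count n ≡ 0
  count-none zero    none = refl
  count-none (suc n) none with A? n
  ... | yes a = ⊥-elim (none n ℕₚ.≤-refl a)
  ... | no  _ = trans (ℕₚ.+-identityʳ _) (count-none n (λ i i<n → none i (ℕₚ.m<n⇒m<1+n i<n)))

  count-all : ∀ n → (∀ i → i < n → A i) → count n ≡ n
  count-all zero    all = refl
  count-all (suc n) all with A? n
  ... | yes _ = trans (cong (_+ 1) (count-all n (λ i i<n → all i (ℕₚ.m<n⇒m<1+n i<n)))) (ℕₚ.+-comm n 1)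
  ... | no ¬a = ⊥-elim (¬a (all n ℕₚ.≤-refl))

  count-unique : ∀ n {i} → i < n → A i → (∀ j → j < n → A j → j ≡ i) → count n ≡ 1
  count-unique (suc n) {i} i<1+n a unique with A? n
  ... | yes aₙ with refl ← unique n ℕₚ.≤-refl aₙ =
    cong (_+ 1) (count-none n (λ j j<n aⱼ → ℕₚ.<-irrefl (unique j (ℕₚ.m<n⇒m<1+n j<n) aⱼ) j<n))
  ... | no ¬aₙ with ℕₚ.m≤n⇒m<n∨m≡n i<1+n
  ...   | inj₁ (s≤s i<n) = trans (ℕₚ.+-identityʳ _) (count-unique n i<n a (λ j j<n → unique j (ℕₚ.m<n⇒m<1+n j<n)))
  ...   | inj₂ refl      = ⊥-elim (¬aₙ a)

  count≡0⇒none : ∀ n → count n ≡ 0 → ∀ i → i < n → ¬ A i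
  count≡0⇒none (suc n) c≡0 i i<1+n a with A? n | ℕₚ.m≤n⇒m<n∨m≡n i<1+n
  ... | yes _  | _                = ℕₚ.1+n≢0 (trans (ℕₚ.+-comm 1 _) c≡0)
  ... | no ¬aₙ | inj₂ refl        = ¬aₙ a
  ... | no _   | inj₁ (s≤s i<n)   = count≡0⇒none n (trans (sym (ℕₚ.+-identityʳ _)) c≡0) i i<n a

  least : ∀ n → A n → ∃ λ m → m ≤ n × A m × (∀ k → k < m → ¬ A k)
  least n a with leastUpTo n
    where
    leastUpTo : ∀ n → (∃ λ m → m ≤ n × A m × (∀ k → k < m → ¬ A k)) ⊎ (∀ k → k ≤ n → ¬ A k)
    leastUpTo zero with A? 0
    ... | yes a₀ = inj₁ (0 , z≤n , a₀ , λ _ ())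
    ... | no ¬a₀ = inj₂ λ { zero _ → ¬a₀ }
    leastUpTo (suc n) with leastUpTo n | A? (suc n)
    ... | inj₁ (m , m≤n , aₘ , below) | _ = inj₁ (m , ℕₚ.m≤n⇒m≤1+n m≤n , aₘ , below)
    ... | inj₂ none | yes a = inj₁ (suc n , ℕₚ.≤-refl , a , λ k k<1+n → none k (ℕₚ.≤-pred k<1+n))
    ... | inj₂ none | no ¬a = inj₂ λ k k≤1+n →
      [ (λ k<1+n → none k (ℕₚ.≤-pred k<1+n)) , (λ { refl → ¬a }) ]′ (ℕₚ.m≤n⇒m<n∨m≡n k≤1+n)
  ... | inj₁ found = found
  ... | inj₂ none  = ⊥-elim (none n ℕₚ.≤-refl a)

module PolynomialRing (F : FiniteField) where
  open FiniteField F
  open Poly F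

  𝔽 : CommutativeRing 0ℓ 0ℓ
  𝔽 = record { isCommutativeRing = isCommutativeRing }

  module 𝔽 = CommutativeRing 𝔽
  open CommSemigroupProperties 𝔽.+-commutativeSemigroup using (interchange; x∙yz≈y∙xz)

  -F0≡0 : -F 0F ≡ 0F
  -F0≡0 = RingProperties.-0#≈0# 𝔽.ring

  *F-noZeroDivisors : ∀ {a b} → a *F b ≡ 0F → a ≢ 0F → b ≡ 0F
  *F-noZeroDivisors {a} {b} ab≡0 a≢0 with inverse a a≢0
  ... | a⁻¹ , aa⁻¹≡1 = begin
    b                ≡⟨ sym (𝔽.*-identityˡ b) ⟩
    1F *F b          ≡⟨ cong (_*F b) (trans (sym aa⁻¹≡1) (𝔽.*-comm a a⁻¹)) ⟩
    (a⁻¹ *F a) *F b  ≡⟨ 𝔽.*-assoc a⁻¹ a b ⟩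
    a⁻¹ *F (a *F b)  ≡⟨ cong (a⁻¹ *F_) ab≡0 ⟩
    a⁻¹ *F 0F        ≡⟨ 𝔽.zeroʳ a⁻¹ ⟩
    0F               ∎
    where open ≡-Reasoning

  coeff : Pol → ℕ → Fin card
  coeff []       _       = 0F
  coeff (c ∷ cs) zero    = c
  coeff (c ∷ cs) (suc i) = coeff cs i

  -- Coefficientwise equality: unlike the normal-form equality _≈_, it is evidently a congruence.
  infix 4 _≋_
  record _≋_ (f g : Pol) : Set where
    constructor mk≋
    field coeff-≡ : ∀ i → coeff f i ≡ coeff g i
  open _≋_ public

  ≋-refl : ∀ {f} → f ≋ f
  ≋-refl = mk≋ λ _ → refl

  ≋-sym : ∀ {f g} → f ≋ g → g ≋ f
  ≋-sym f≋g = mk≋ λ i → sym (coeff-≡ f≋g i)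

  ≋-trans : ∀ {f g h} → f ≋ g → g ≋ h → f ≋ h
  ≋-trans f≋g g≋h = mk≋ λ i → trans (coeff-≡ f≋g i) (coeff-≡ g≋h i)

  ≋-setoid : Setoid 0ℓ 0ℓ
  ≋-setoid = record
    { Carrier = Pol ; _≈_ = _≋_
    ; isEquivalence = record { refl = ≋-refl ; sym = ≋-sym ; trans = ≋-trans } }

  ∷-cong : ∀ {c d f g} → c ≡ d → f ≋ g → (c ∷ f) ≋ (d ∷ g)
  ∷-cong c≡d f≋g = mk≋ λ { zero → c≡d ; (suc i) → coeff-≡ f≋g i }

  ∷-injective : ∀ {c d f g} → (c ∷ f) ≋ (d ∷ g) → c ≡ d × f ≋ g
  ∷-injective c∷f≋d∷g = coeff-≡ c∷f≋d∷g 0 , mk≋ λ i → coeff-≡ c∷f≋d∷g (suc i)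

  ∷≋[]-inverse : ∀ {c f} → (c ∷ f) ≋ [] → c ≡ 0F × f ≋ []
  ∷≋[]-inverse c∷f≋0 = coeff-≡ c∷f≋0 0 , mk≋ λ i → coeff-≡ c∷f≋0 (suc i)

  coeff-+P : ∀ f g i → coeff (f +P g) i ≡ coeff f i +F coeff g i
  coeff-+P []       g        i       = sym (𝔽.+-identityˡ _)
  coeff-+P (c ∷ cs) []       i       = sym (𝔽.+-identityʳ _)
  coeff-+P (c ∷ cs) (d ∷ ds) zero    = refl
  coeff-+P (c ∷ cs) (d ∷ ds) (suc i) = coeff-+P cs ds i

  coeff-negP : ∀ f i → coeff (-P f) i ≡ -F coeff f i
  coeff-negP []       i       = sym -F0≡0
  coeff-negP (c ∷ cs) zero    = refl
  coeff-negP (c ∷ cs) (suc i) = coeff-negP cs i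

  coeff-scale : ∀ c f i → coeff (scale c f) i ≡ c *F coeff f i
  coeff-scale c []       i       = sym (𝔽.zeroʳ c)
  coeff-scale c (d ∷ ds) zero    = refl
  coeff-scale c (d ∷ ds) (suc i) = coeff-scale c ds i

  +P-cong : ∀ {f f′ g g′} → f ≋ f′ → g ≋ g′ → (f +P g) ≋ (f′ +P g′)
  +P-cong {f} {f′} {g} {g′} f≋f′ g≋g′ = mk≋ λ i → begin
    coeff (f +P g) i          ≡⟨ coeff-+P f g i ⟩
    coeff f i +F coeff g i    ≡⟨ cong₂ _+F_ (coeff-≡ f≋f′ i) (coeff-≡ g≋g′ i) ⟩
    coeff f′ i +F coeff g′ i  ≡⟨ coeff-+P f′ g′ i ⟨
    coeff (f′ +P g′) i        ∎
    where open ≡-Reasoning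

  negP-cong : ∀ {f f′} → f ≋ f′ → (-P f) ≋ (-P f′)
  negP-cong {f} {f′} f≋f′ = mk≋ λ i →
    trans (coeff-negP f i) (trans (cong -F_ (coeff-≡ f≋f′ i)) (sym (coeff-negP f′ i)))

  scale-cong : ∀ c {f f′} → f ≋ f′ → scale c f ≋ scale c f′
  scale-cong c {f} {f′} f≋f′ = mk≋ λ i →
    trans (coeff-scale c f i) (trans (cong (c *F_) (coeff-≡ f≋f′ i)) (sym (coeff-scale c f′ i)))

  +P-comm : ∀ f g → (f +P g) ≋ (g +P f)
  +P-comm f g = mk≋ λ i → trans (coeff-+P f g i) (trans (𝔽.+-comm _ _) (sym (coeff-+P g f i)))

  +P-assoc : ∀ f g h → ((f +P g) +P h) ≋ (f +P (g +P h))
  +P-assoc f g h = mk≋ λ i → begin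
    coeff ((f +P g) +P h) i                    ≡⟨ trans (coeff-+P (f +P g) h i) (cong (_+F coeff h i) (coeff-+P f g i)) ⟩
    (coeff f i +F coeff g i) +F coeff h i      ≡⟨ 𝔽.+-assoc _ _ _ ⟩
    coeff f i +F (coeff g i +F coeff h i)      ≡⟨ trans (coeff-+P f (g +P h) i) (cong (coeff f i +F_) (coeff-+P g h i)) ⟨
    coeff (f +P (g +P h)) i                    ∎
    where open ≡-Reasoning

  +P-identityʳ : ∀ f → (f +P []) ≋ f
  +P-identityʳ f = mk≋ λ i → trans (coeff-+P f [] i) (𝔽.+-identityʳ _)

  +P-inverseʳ : ∀ f → (f +P (-P f)) ≋ []
  +P-inverseʳ f = mk≋ λ i →
    trans (coeff-+P f (-P f) i) (trans (cong (coeff f i +F_) (coeff-negP f i)) (𝔽.-‿inverseʳ _))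

  +P-interchange : ∀ f g h k → ((f +P g) +P (h +P k)) ≋ ((f +P h) +P (g +P k))
  +P-interchange f g h k = mk≋ λ i → begin
    coeff ((f +P g) +P (h +P k)) i
      ≡⟨ trans (coeff-+P (f +P g) (h +P k) i) (cong₂ _+F_ (coeff-+P f g i) (coeff-+P h k i)) ⟩
    (coeff f i +F coeff g i) +F (coeff h i +F coeff k i)
      ≡⟨ interchange _ _ _ _ ⟩
    (coeff f i +F coeff h i) +F (coeff g i +F coeff k i)
      ≡⟨ trans (coeff-+P (f +P h) (g +P k) i) (cong₂ _+F_ (coeff-+P f h i) (coeff-+P g k i)) ⟨
    coeff ((f +P h) +P (g +P k)) i ∎
    where open ≡-Reasoning

  +P-leftComm : ∀ f g h → (f +P (g +P h)) ≋ (g +P (f +P h))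
  +P-leftComm f g h = mk≋ λ i → begin
    coeff (f +P (g +P h)) i                ≡⟨ trans (coeff-+P f (g +P h) i) (cong (coeff f i +F_) (coeff-+P g h i)) ⟩
    coeff f i +F (coeff g i +F coeff h i)  ≡⟨ x∙yz≈y∙xz _ _ _ ⟩
    coeff g i +F (coeff f i +F coeff h i)  ≡⟨ trans (coeff-+P g (f +P h) i) (cong (coeff g i +F_) (coeff-+P f h i)) ⟨
    coeff (g +P (f +P h)) i                ∎
    where open ≡-Reasoning

  scale-distribʳ : ∀ c d f → scale (c +F d) f ≋ (scale c f +P scale d f)
  scale-distribʳ c d f = mk≋ λ i → begin
    coeff (scale (c +F d) f) i                      ≡⟨ coeff-scale (c +F d) f i ⟩
    (c +F d) *F coeff f i                           ≡⟨ 𝔽.distribʳ _ _ _ ⟩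
    (c *F coeff f i) +F (d *F coeff f i)            ≡⟨ cong₂ _+F_ (coeff-scale c f i) (coeff-scale d f i) ⟨
    coeff (scale c f) i +F coeff (scale d f) i      ≡⟨ coeff-+P (scale c f) (scale d f) i ⟨
    coeff (scale c f +P scale d f) i                ∎
    where open ≡-Reasoning

  scale-distribˡ : ∀ c f g → scale c (f +P g) ≋ (scale c f +P scale c g)
  scale-distribˡ c f g = mk≋ λ i → begin
    coeff (scale c (f +P g)) i                      ≡⟨ trans (coeff-scale c (f +P g) i) (cong (c *F_) (coeff-+P f g i)) ⟩
    c *F (coeff f i +F coeff g i)                   ≡⟨ 𝔽.distribˡ _ _ _ ⟩
    (c *F coeff f i) +F (c *F coeff g i)            ≡⟨ cong₂ _+F_ (coeff-scale c f i) (coeff-scale c g i) ⟨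
    coeff (scale c f) i +F coeff (scale c g) i      ≡⟨ coeff-+P (scale c f) (scale c g) i ⟨
    coeff (scale c f +P scale c g) i                ∎
    where open ≡-Reasoning

  scale-assoc : ∀ c d f → scale c (scale d f) ≋ scale (c *F d) f
  scale-assoc c d f = mk≋ λ i →
    trans (coeff-scale c (scale d f) i) (trans (cong (c *F_) (coeff-scale d f i))
      (trans (sym (𝔽.*-assoc _ _ _)) (sym (coeff-scale (c *F d) f i))))

  scale-identity : ∀ f → scale 1F f ≋ f
  scale-identity f = mk≋ λ i → trans (coeff-scale 1F f i) (𝔽.*-identityˡ _)

  scale-zeroˡ : ∀ f → scale 0F f ≋ []
  scale-zeroˡ f = mk≋ λ i → trans (coeff-scale 0F f i) (𝔽.zeroˡ _)

  0∷[]≋[] : (0F ∷ []) ≋ []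
  0∷[]≋[] = mk≋ λ { zero → refl ; (suc i) → refl }

  *P-zeroˡ : ∀ {f} g → f ≋ [] → (f *P g) ≋ []
  *P-zeroˡ {[]}     g _ = ≋-refl
  *P-zeroˡ {c ∷ cs} g c∷cs≋0 with c≡0 , cs≋0 ← ∷≋[]-inverse c∷cs≋0 =
    +P-cong (subst (λ x → scale x g ≋ []) (sym c≡0) (scale-zeroˡ g))
            (≋-trans (∷-cong refl (*P-zeroˡ g cs≋0)) 0∷[]≋[])

  *P-zeroʳ : ∀ f → (f *P []) ≋ []
  *P-zeroʳ []       = ≋-refl
  *P-zeroʳ (c ∷ cs) = ≋-trans (∷-cong refl (*P-zeroʳ cs)) 0∷[]≋[]

  *P-congˡ : ∀ {f f′} g → f ≋ f′ → (f *P g) ≋ (f′ *P g)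
  *P-congˡ {[]}     {[]}     g _    = ≋-refl
  *P-congˡ {[]}     {d ∷ ds} g 0≋f′ = ≋-sym (*P-zeroˡ g (≋-sym 0≋f′))
  *P-congˡ {c ∷ cs} {[]}     g f≋0  = *P-zeroˡ g f≋0
  *P-congˡ {c ∷ cs} {d ∷ ds} g f≋f′ with c≡d , cs≋ds ← ∷-injective f≋f′ =
    +P-cong (subst (λ x → scale c g ≋ scale x g) c≡d ≋-refl) (∷-cong refl (*P-congˡ g cs≋ds))

  *P-congʳ : ∀ f {g g′} → g ≋ g′ → (f *P g) ≋ (f *P g′)
  *P-congʳ []       g≋g′ = ≋-refl
  *P-congʳ (c ∷ cs) g≋g′ = +P-cong (scale-cong c g≋g′) (∷-cong refl (*P-congʳ cs g≋g′))

  *P-cong : ∀ {f f′ g g′} → f ≋ f′ → g ≋ g′ → (f *P g) ≋ (f′ *P g′)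
  *P-cong {f′ = f′} {g = g} f≋f′ g≋g′ = ≋-trans (*P-congˡ g f≋f′) (*P-congʳ f′ g≋g′)

  *P-distribʳ : ∀ f g h → ((f +P g) *P h) ≋ ((f *P h) +P (g *P h))
  *P-distribʳ []       g        h = ≋-refl
  *P-distribʳ (c ∷ cs) []       h = ≋-sym (+P-identityʳ _)
  *P-distribʳ (c ∷ cs) (d ∷ ds) h = begin
    scale (c +F d) h +P (0F ∷ ((cs +P ds) *P h))
      ≈⟨ +P-cong (scale-distribʳ c d h) (∷-cong (sym (𝔽.+-identityˡ 0F)) (*P-distribʳ cs ds h)) ⟩
    (scale c h +P scale d h) +P ((0F ∷ (cs *P h)) +P (0F ∷ (ds *P h)))
      ≈⟨ +P-interchange (scale c h) (scale d h) _ _ ⟩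
    ((c ∷ cs) *P h) +P ((d ∷ ds) *P h) ∎
    where open SetoidReasoning ≋-setoid

  *P-distribˡ : ∀ f g h → (f *P (g +P h)) ≋ ((f *P g) +P (f *P h))
  *P-distribˡ []       g h = ≋-refl
  *P-distribˡ (c ∷ cs) g h = begin
    scale c (g +P h) +P (0F ∷ (cs *P (g +P h)))
      ≈⟨ +P-cong (scale-distribˡ c g h) (∷-cong (sym (𝔽.+-identityˡ 0F)) (*P-distribˡ cs g h)) ⟩
    (scale c g +P scale c h) +P ((0F ∷ (cs *P g)) +P (0F ∷ (cs *P h)))
      ≈⟨ +P-interchange (scale c g) (scale c h) _ _ ⟩
    ((c ∷ cs) *P g) +P ((c ∷ cs) *P h) ∎
    where open SetoidReasoning ≋-setoid

  *P-∷ : ∀ f d ds → (f *P (d ∷ ds)) ≋ (scale d f +P (0F ∷ (f *P ds)))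
  *P-∷ []       d ds = ≋-sym 0∷[]≋[]
  *P-∷ (c ∷ cs) d ds =
    ∷-cong (trans (𝔽.+-identityʳ _) (trans (𝔽.*-comm c d) (sym (𝔽.+-identityʳ _))))
           (≋-trans (+P-cong (≋-refl {scale c ds}) (*P-∷ cs d ds)) (+P-leftComm (scale c ds) (scale d cs) _))

  *P-comm : ∀ f g → (f *P g) ≋ (g *P f)
  *P-comm []       g = ≋-sym (*P-zeroʳ g)
  *P-comm (c ∷ cs) g = ≋-trans (+P-cong (≋-refl {scale c g}) (∷-cong refl (*P-comm cs g))) (≋-sym (*P-∷ g c cs))

  scale-*P : ∀ c f g → (scale c f *P g) ≋ scale c (f *P g)
  scale-*P c []       g = ≋-refl
  scale-*P c (d ∷ ds) g = begin
    scale (c *F d) g +P (0F ∷ (scale c ds *P g))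
      ≈⟨ +P-cong (≋-sym (scale-assoc c d g)) (∷-cong (sym (𝔽.zeroʳ c)) (scale-*P c ds g)) ⟩
    scale c (scale d g) +P scale c (0F ∷ (ds *P g))
      ≈⟨ scale-distribˡ c (scale d g) _ ⟨
    scale c ((d ∷ ds) *P g) ∎
    where open SetoidReasoning ≋-setoid

  *P-assoc : ∀ f g h → ((f *P g) *P h) ≋ (f *P (g *P h))
  *P-assoc []       g h = ≋-refl
  *P-assoc (c ∷ cs) g h =
    ≋-trans (*P-distribʳ (scale c g) (0F ∷ (cs *P g)) h)
            (+P-cong (scale-*P c g h) (≋-trans (+P-cong (scale-zeroˡ h) ≋-refl) (∷-cong refl (*P-assoc cs g h))))

  *P-identityˡ : ∀ f → (1P *P f) ≋ f
  *P-identityˡ f = ≋-trans (+P-cong (≋-refl {scale 1F f}) 0∷[]≋[]) (≋-trans (+P-identityʳ _) (scale-identity f))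

  *P-identityʳ : ∀ f → (f *P 1P) ≋ f
  *P-identityʳ f = ≋-trans (*P-comm f 1P) (*P-identityˡ f)

  ℙ : CommutativeRing 0ℓ 0ℓ
  ℙ = record
    { Carrier = Pol ; _≈_ = _≋_ ; _+_ = _+P_ ; _*_ = _*P_ ; -_ = -P_ ; 0# = [] ; 1# = 1P
    ; isCommutativeRing = record
      { isRing = record
        { +-isAbelianGroup = record
          { isGroup = record
            { isMonoid = record
              { isSemigroup = record
                { isMagma = record { isEquivalence = Setoid.isEquivalence ≋-setoid ; ∙-cong = +P-cong }
                ; assoc = +P-assoc }
              ; identity = (λ _ → ≋-refl) , +P-identityʳ }
            ; inverse = (λ f → ≋-trans (+P-comm (-P f) f) (+P-inverseʳ f)) , +P-inverseʳ
            ; ⁻¹-cong = negP-cong }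
          ; comm = +P-comm }
        ; *-cong = *P-cong
        ; *-assoc = *P-assoc
        ; *-identity = *P-identityˡ , *P-identityʳ
        ; distrib = *P-distribˡ , λ f g h → *P-distribʳ g h f }
      ; *-comm = *P-comm } }

  module ℙ = CommutativeRing ℙ
  module ℙₚ = RingProperties ℙ.ring

  normCons : Fin card → Pol → Pol
  normCons c (d ∷ ds) = c ∷ d ∷ ds
  normCons c [] with c Finₚ.≟ 0F
  ... | yes _ = []
  ... | no  _ = c ∷ []

  norm-∷ : ∀ c cs → norm (c ∷ cs) ≡ normCons c (norm cs)
  norm-∷ c cs with norm cs
  ... | d ∷ ds = refl
  ... | [] with c Finₚ.≟ 0F
  ...   | yes _ = refl
  ...   | no  _ = refl

  normCons-≋ : ∀ c f → normCons c f ≋ (c ∷ f)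
  normCons-≋ c (d ∷ ds) = ≋-refl
  normCons-≋ c [] with c Finₚ.≟ 0F
  ... | yes c≡0 = ≋-sym (≋-trans (∷-cong c≡0 ≋-refl) 0∷[]≋[])
  ... | no  _   = ≋-refl

  norm-≋ : ∀ f → norm f ≋ f
  norm-≋ []       = ≋-refl
  norm-≋ (c ∷ cs) rewrite norm-∷ c cs = ≋-trans (normCons-≋ c (norm cs)) (∷-cong refl (norm-≋ cs))

  ≋[]⇒norm≡[] : ∀ {f} → f ≋ [] → norm f ≡ []
  ≋[]⇒norm≡[] {[]}     _   = refl
  ≋[]⇒norm≡[] {c ∷ cs} f≋0 with c≡0 , cs≋0 ← ∷≋[]-inverse f≋0
    rewrite norm-∷ c cs | ≋[]⇒norm≡[] cs≋0 with c Finₚ.≟ 0F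
  ... | yes _   = refl
  ... | no  c≢0 = ⊥-elim (c≢0 c≡0)

  ≋⇒≈ : ∀ {f g} → f ≋ g → f ≈ g
  ≋⇒≈ {[]}     {g}      0≋g = sym (≋[]⇒norm≡[] (≋-sym 0≋g))
  ≋⇒≈ {c ∷ cs} {[]}     f≋0 = ≋[]⇒norm≡[] f≋0
  ≋⇒≈ {c ∷ cs} {d ∷ ds} f≋g with c≡d , cs≋ds ← ∷-injective f≋g
    rewrite norm-∷ c cs | norm-∷ d ds = cong₂ normCons c≡d (≋⇒≈ cs≋ds)

  ≈⇒≋ : ∀ {f g} → f ≈ g → f ≋ g
  ≈⇒≋ {f} {g} f≈g = ≋-trans (≋-sym (norm-≋ f)) (subst (_≋ g) (sym f≈g) (norm-≋ g))

  [y-v]-[y-u]≋u-v : ∀ y u v → ((y -P v) -P (y -P u)) ≋ (u -P v)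
  [y-v]-[y-u]≋u-v y u v = begin
    (y -P v) -P (y -P u)        ≈⟨ +P-cong (≋-refl {y -P v}) (ℙₚ.⁻¹-anti-homo‿- y u) ⟩
    (y -P v) +P (u -P y)        ≈⟨ +P-comm (y -P v) (u -P y) ⟩
    (u -P y) +P (y -P v)        ≈⟨ +P-assoc u (-P y) (y -P v) ⟩
    u +P ((-P y) +P (y -P v))   ≈⟨ +P-cong (≋-refl {u}) (ℙₚ.\\-leftDividesʳ y (-P v)) ⟩
    u -P v                      ∎
    where open SetoidReasoning ≋-setoid

  y-[x+u]≋[y-x]-u : ∀ y x u → (y -P (x +P u)) ≋ ((y -P x) -P u)
  y-[x+u]≋[y-x]-u y x u = begin
    y -P (x +P u)               ≈⟨ +P-cong (≋-refl {y}) (ℙₚ.-‿+-comm x u) ⟨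
    y +P ((-P x) +P (-P u))     ≈⟨ +P-assoc y (-P x) (-P u) ⟨
    (y -P x) -P u               ∎
    where open SetoidReasoning ≋-setoid

  ≋+⇒≋- : ∀ {y a r} → y ≋ (a +P r) → r ≋ (y -P a)
  ≋+⇒≋- {y} {a} {r} y≋a+r = ≋-sym (begin
    y -P a         ≈⟨ +P-cong (≋-trans y≋a+r (+P-comm a r)) ≋-refl ⟩
    (r +P a) -P a  ≈⟨ ℙₚ.//-rightDividesʳ a r ⟩
    r              ∎)
    where open SetoidReasoning ≋-setoid

module Degrees (F : FiniteField) where
  open FiniteField F
  open Poly F
  open PolynomialRing F

  record DegreeBelow (f : Pol) (m : ℕ) : Set where
    constructor mkDegreeBelow
    field vanishes : ∀ i → m ≤ i → coeff f i ≡ 0F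
  open DegreeBelow public

  record HasDegree (f : Pol) (n : ℕ) : Set where
    constructor mkHasDegree
    field leading≢0 : coeff f n ≢ 0F
          below     : DegreeBelow f (suc n)
  open HasDegree public

  DegreeBelow-resp-≋ : ∀ {f g m} → f ≋ g → DegreeBelow f m → DegreeBelow g m
  DegreeBelow-resp-≋ f≋g f<m = mkDegreeBelow λ i m≤i → trans (sym (coeff-≡ f≋g i)) (vanishes f<m i m≤i)

  HasDegree-resp-≋ : ∀ {f g n} → f ≋ g → HasDegree f n → HasDegree g n
  HasDegree-resp-≋ {n = n} f≋g (mkHasDegree lc≢0 f<n) =
    mkHasDegree (λ lc≡0 → lc≢0 (trans (coeff-≡ f≋g n) lc≡0)) (DegreeBelow-resp-≋ f≋g f<n)

  ∷-DegreeBelow : ∀ {c f m} → DegreeBelow (c ∷ f) (suc m) → DegreeBelow f m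
  ∷-DegreeBelow c∷f<1+m = mkDegreeBelow λ i m≤i → vanishes c∷f<1+m (suc i) (s≤s m≤i)

  ≋[]⇒DegreeBelow : ∀ {f} m → f ≋ [] → DegreeBelow f m
  ≋[]⇒DegreeBelow m f≋0 = mkDegreeBelow λ i _ → coeff-≡ f≋0 i

  DegreeBelow-0⇒≋[] : ∀ {f} → DegreeBelow f 0 → f ≋ []
  DegreeBelow-0⇒≋[] f<0 = mk≋ λ i → vanishes f<0 i z≤n

  HasDegree⇒≉[] : ∀ {f n} → HasDegree f n → ¬ f ≋ []
  HasDegree⇒≉[] {n = n} f°n f≋0 = leading≢0 f°n (coeff-≡ f≋0 n)

  HasDegree⇒< : ∀ {f n m} → HasDegree f n → DegreeBelow f m → n < m
  HasDegree⇒< {n = n} {m} f°n f<m with n ℕₚ.<? m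
  ... | yes n<m = n<m
  ... | no  n≮m = ⊥-elim (leading≢0 f°n (vanishes f<m n (ℕₚ.≮⇒≥ n≮m)))

  HasDegree-unique : ∀ {f m n} → HasDegree f m → HasDegree f n → m ≡ n
  HasDegree-unique f°m f°n =
    ℕₚ.≤-antisym (ℕₚ.≤-pred (HasDegree⇒< f°m (below f°n))) (ℕₚ.≤-pred (HasDegree⇒< f°n (below f°m)))

  coeff--P : ∀ f g i → coeff (f -P g) i ≡ coeff f i +F (-F coeff g i)
  coeff--P f g i = trans (coeff-+P f (-P g) i) (cong (coeff f i +F_) (coeff-negP g i))

  DegreeBelow-pred : ∀ {f m} → DegreeBelow f (suc m) → coeff f m ≡ 0F → DegreeBelow f m
  DegreeBelow-pred {m = m} f<1+m fₘ≡0 = mkDegreeBelow λ i m≤i → case ℕₚ.m≤n⇒m<n∨m≡n m≤i of λ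
    { (inj₁ m<i) → vanishes f<1+m i m<i
    ; (inj₂ refl) → fₘ≡0 }

  DegreeBelow-scale : ∀ {f m} c → DegreeBelow f m → DegreeBelow (scale c f) m
  DegreeBelow-scale {f} c f<m = mkDegreeBelow λ i m≤i →
    trans (coeff-scale c f i) (trans (cong (c *F_) (vanishes f<m i m≤i)) (𝔽.zeroʳ c))

  DegreeBelow--P : ∀ {f g m} → DegreeBelow f m → DegreeBelow g m → DegreeBelow (f -P g) m
  DegreeBelow--P {f} {g} f<m g<m = mkDegreeBelow λ i m≤i → begin
    coeff (f -P g) i               ≡⟨ coeff--P f g i ⟩
    coeff f i +F (-F coeff g i)    ≡⟨ cong₂ (λ a b → a +F (-F b)) (vanishes f<m i m≤i) (vanishes g<m i m≤i) ⟩
    0F +F (-F 0F)                  ≡⟨ 𝔽.-‿inverseʳ 0F ⟩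
    0F                             ∎
    where open ≡-Reasoning

  norm≡∷⇒HasDegree : ∀ f {c cs} → norm f ≡ c ∷ cs → HasDegree f (length cs)
  norm≡∷⇒HasDegree (d ∷ ds) norm≡ rewrite norm-∷ d ds with norm ds in norm-ds≡
  ... | x ∷ xs with refl ← norm≡ =
    let ds°n = norm≡∷⇒HasDegree ds norm-ds≡ in
    mkHasDegree (leading≢0 ds°n) (mkDegreeBelow λ { zero () ; (suc i) (s≤s n<i) → vanishes (below ds°n) i n<i })
  ... | [] with d Finₚ.≟ 0F | norm≡
  ...   | no d≢0 | refl = mkHasDegree d≢0 (mkDegreeBelow λ { zero () ; (suc i) _ → coeff-≡ (≈⇒≋ {ds} {[]} norm-ds≡) i })

  ≋[]-or-HasDegree : ∀ f → f ≋ [] ⊎ ∃ (HasDegree f)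
  ≋[]-or-HasDegree f with norm f in norm-f≡
  ... | []     = inj₁ (≈⇒≋ {f} {[]} norm-f≡)
  ... | c ∷ cs = inj₂ (length cs , norm≡∷⇒HasDegree f norm-f≡)

  HasDegree⇒deg≡ : ∀ {f n} → HasDegree f n → deg f ≡ n
  HasDegree⇒deg≡ {f} f°n with norm f in norm-f≡
  ... | []     = ⊥-elim (HasDegree⇒≉[] f°n (≈⇒≋ {f} {[]} norm-f≡))
  ... | c ∷ cs = HasDegree-unique (norm≡∷⇒HasDegree f norm-f≡) f°n

  coeff-∷-*P : ∀ c cs g i → coeff ((c ∷ cs) *P g) i ≡ (c *F coeff g i) +F coeff (0F ∷ (cs *P g)) i
  coeff-∷-*P c cs g i = trans (coeff-+P (scale c g) _ i) (cong (_+F _) (coeff-scale c g i))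

  *P-leading : ∀ f g m n → DegreeBelow f (suc m) → DegreeBelow g (suc n) →
               DegreeBelow (f *P g) (suc (m + n)) × coeff (f *P g) (m + n) ≡ coeff f m *F coeff g n
  *P-leading []       g m n _ _ = ≋[]⇒DegreeBelow _ ≋-refl , sym (𝔽.zeroˡ _)
  *P-leading (c ∷ cs) g zero n c∷cs<1 g<1+n =
    mkDegreeBelow (λ i n<i → trans (coeff≡ i) (trans (cong (c *F_) (vanishes g<1+n i n<i)) (𝔽.zeroʳ c))) , coeff≡ n
    where
    cs*g≋0 : (cs *P g) ≋ []
    cs*g≋0 = *P-zeroˡ g (DegreeBelow-0⇒≋[] (∷-DegreeBelow c∷cs<1))
    coeff≡ : ∀ i → coeff ((c ∷ cs) *P g) i ≡ c *F coeff g i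
    coeff≡ i = trans (coeff-∷-*P c cs g i)
      (trans (cong ((c *F coeff g i) +F_) (coeff-≡ (≋-trans (∷-cong refl cs*g≋0) 0∷[]≋[]) i)) (𝔽.+-identityʳ _))
  *P-leading (c ∷ cs) g (suc m) n c∷cs<2+m g<1+n =
    mkDegreeBelow (λ { zero () ; (suc i) (s≤s m+n<i) → trans (coeff-suc i (n≤ m+n<i)) (vanishes (proj₁ IH) i m+n<i) })
    , trans (coeff-suc (m + n) (ℕₚ.m≤n+m n m)) (proj₂ IH)
    where
    IH = *P-leading cs g m n (∷-DegreeBelow c∷cs<2+m) g<1+n
    n≤ : ∀ {i} → suc (m + n) ≤ i → n ≤ i
    n≤ m+n<i = ℕₚ.≤-trans (ℕₚ.m≤n+m n m) (ℕₚ.<⇒≤ m+n<i)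
    coeff-suc : ∀ i → n ≤ i → coeff ((c ∷ cs) *P g) (suc i) ≡ coeff (cs *P g) i
    coeff-suc i n≤i = trans (coeff-∷-*P c cs g (suc i))
      (trans (cong (_+F coeff (cs *P g) i) (trans (cong (c *F_) (vanishes g<1+n (suc i) (s≤s n≤i))) (𝔽.zeroʳ c)))
             (𝔽.+-identityˡ _))

  HasDegree-*P : ∀ {f g m n} → HasDegree f m → HasDegree g n → HasDegree (f *P g) (m + n)
  HasDegree-*P {f} {g} {m} {n} f°m g°n with f*g<1+m+n , top ← *P-leading f g m n (below f°m) (below g°n) =
    mkHasDegree (λ top≡0 → leading≢0 g°n (*F-noZeroDivisors (trans (sym top) top≡0) (leading≢0 f°m))) f*g<1+m+n

  HasDegree-1P : HasDegree 1P 0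
  HasDegree-1P = mkHasDegree (λ 1≡0 → 0≢1 (sym 1≡0)) (mkDegreeBelow λ { zero () ; (suc i) _ → refl })

  HasDegree-^P : ∀ {f n} → HasDegree f n → ∀ k → HasDegree (f ^P k) (k * n)
  HasDegree-^P f°n zero    = HasDegree-1P
  HasDegree-^P f°n (suc k) = HasDegree-*P f°n (HasDegree-^P f°n k)

  *P-≉[] : ∀ {f g} → ¬ f ≋ [] → ¬ g ≋ [] → ¬ (f *P g) ≋ []
  *P-≉[] {f} {g} f≉0 g≉0 with ≋[]-or-HasDegree f | ≋[]-or-HasDegree g
  ... | inj₁ f≋0      | _             = ⊥-elim (f≉0 f≋0)
  ... | inj₂ _        | inj₁ g≋0      = ⊥-elim (g≉0 g≋0)
  ... | inj₂ (_ , f°) | inj₂ (_ , g°) = HasDegree⇒≉[] (HasDegree-*P f° g°)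

  *P-cancelˡ : ∀ {f g h} → ¬ f ≋ [] → (f *P g) ≋ (f *P h) → g ≋ h
  *P-cancelˡ {f} {g} {h} f≉0 fg≋fh with ≋[]-or-HasDegree (g -P h)
  ... | inj₁ g-h≋0 = ℙₚ.x∙y⁻¹≈ε⇒x≈y g h g-h≋0
  ... | inj₂ (_ , g-h°) = ⊥-elim (*P-≉[] f≉0 (HasDegree⇒≉[] g-h°)
                                  (≋-trans (ℙₚ.x[y-z]≈xy-xz f g h) (ℙₚ.x≈y⇒x∙y⁻¹≈ε fg≋fh)))

  HasDegree-0⇒unit : ∀ {f} → HasDegree f 0 → ∃ λ g → (g *P f) ≋ 1P
  HasDegree-0⇒unit {f} f°0 with c⁻¹ , f₀c⁻¹≡1 ← inverse (coeff f 0) (leading≢0 f°0) =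
    (c⁻¹ ∷ []) , ≋-trans (+P-cong (≋-refl {scale c⁻¹ f}) 0∷[]≋[]) (≋-trans (+P-identityʳ _) (mk≋ coeff≡))
    where
    coeff≡ : ∀ i → coeff (scale c⁻¹ f) i ≡ coeff 1P i
    coeff≡ zero    = trans (coeff-scale c⁻¹ f 0) (trans (𝔽.*-comm c⁻¹ _) f₀c⁻¹≡1)
    coeff≡ (suc i) = trans (coeff-scale c⁻¹ f (suc i))
                           (trans (cong (c⁻¹ *F_) (vanishes (below f°0) (suc i) (s≤s z≤n))) (𝔽.zeroʳ c⁻¹))

  1≤deg⇒HasDegree : ∀ {f} → 1 ≤ deg f → HasDegree f (deg f)
  1≤deg⇒HasDegree {f} 1≤deg with ≋[]-or-HasDegree f
  ... | inj₁ f≋0       = ⊥-elim (ℕₚ.<⇒≢ 1≤deg (sym (cong (λ g → length g ∸ 1) (≋⇒≈ f≋0))))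
  ... | inj₂ (n , f°n) = subst (HasDegree f) (sym (HasDegree⇒deg≡ f°n)) f°n

module Division (F : FiniteField) where
  open FiniteField F
  open Poly F
  open PolynomialRing F
  open Degrees F

  infix 4 _∣_
  record _∣_ (f g : Pol) : Set where
    constructor divides
    field quotient   : Pol
          quotient-≋ : (f *P quotient) ≋ g
  open _∣_ public

  ∣-respʳ : ∀ {f g g′} → g ≋ g′ → f ∣ g → f ∣ g′
  ∣-respʳ g≋g′ (divides h fh≋g) = divides h (≋-trans fh≋g g≋g′)

  ∣-refl : ∀ {f} → f ∣ f
  ∣-refl {f} = divides 1P (*P-identityʳ f)

  f∣f*g : ∀ f g → f ∣ (f *P g)
  f∣f*g f g = divides g ≋-refl

  ∣-trans : ∀ {f g h} → f ∣ g → g ∣ h → f ∣ h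
  ∣-trans {f} (divides a fa≋g) (divides b gb≋h) =
    divides (a *P b) (≋-trans (≋-sym (*P-assoc f a b)) (≋-trans (*P-congˡ b fa≋g) gb≋h))

  ∣g⇒∣g*h : ∀ {f g} h → f ∣ g → f ∣ (g *P h)
  ∣g⇒∣g*h {f} h f∣g = ∣-trans f∣g (f∣f*g _ h)

  ∣g⇒∣h*g : ∀ {f g} h → f ∣ g → f ∣ (h *P g)
  ∣g⇒∣h*g {f} {g} h f∣g = ∣-respʳ (*P-comm g h) (∣g⇒∣g*h h f∣g)

  ∣g∣h⇒∣g-h : ∀ {f g h} → f ∣ g → f ∣ h → f ∣ (g -P h)
  ∣g∣h⇒∣g-h {f} (divides a fa≋g) (divides b fb≋h) =
    divides (a -P b) (≋-trans (ℙₚ.x[y-z]≈xy-xz f a b) (+P-cong fa≋g (negP-cong fb≋h)))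

  ∣⇒∣P : ∀ {f g} → f ∣ g → f ∣P g
  ∣⇒∣P (divides h fh≋g) = h , ≋⇒≈ fh≋g

  ∣P⇒∣ : ∀ {f g} → f ∣P g → f ∣ g
  ∣P⇒∣ (h , fh≈g) = divides h (≈⇒≋ fh≈g)

  record DivMod (D y : Pol) (m : ℕ) : Set where
    constructor mkDivMod
    field quo      : Pol
          rem      : Pol
          divMod-≋ : y ≋ ((D *P quo) +P rem)
          rem<     : DegreeBelow rem m

  divMod : ∀ {D m} → HasDegree D m → ∀ y → DivMod D y m
  divMod {D} {m} D°m [] = mkDivMod [] [] (≋-sym (≋-trans (+P-identityʳ _) (*P-zeroʳ D))) (≋[]⇒DegreeBelow m ≋-refl)
  divMod {D} {m} D°m (c ∷ y) with mkDivMod s r′ y≋Ds+r′ r′<m ← divMod D°m y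
                                  | lc⁻¹ , lc*lc⁻¹≡1 ← inverse (coeff D m) (leading≢0 D°m) =
    mkDivMod ((0F ∷ s) +P (k ∷ [])) r c∷y≋ r<m
    where
    u = c ∷ r′
    k = coeff u m *F lc⁻¹
    r = u -P scale k D
    c∷y≋ : (c ∷ y) ≋ ((D *P ((0F ∷ s) +P (k ∷ []))) +P r)
    c∷y≋ = begin
      c ∷ y                                           ≈⟨ ∷-cong (sym (𝔽.+-identityˡ c)) y≋Ds+r′ ⟩
      (0F ∷ (D *P s)) +P u                             ≈⟨ +P-cong (≋-sym D*0∷s≋) (≋-sym (ℙₚ.//-rightDividesˡ (scale k D) u)) ⟩
      (D *P (0F ∷ s)) +P (r +P scale k D)              ≈⟨ +P-cong (≋-refl {D *P (0F ∷ s)}) (+P-comm r (scale k D)) ⟩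
      (D *P (0F ∷ s)) +P (scale k D +P r)              ≈⟨ +P-assoc (D *P (0F ∷ s)) (scale k D) r ⟨
      ((D *P (0F ∷ s)) +P scale k D) +P r              ≈⟨ +P-cong (+P-cong (≋-refl {D *P (0F ∷ s)}) (≋-sym D*k≋)) (≋-refl {r}) ⟩
      ((D *P (0F ∷ s)) +P (D *P (k ∷ []))) +P r        ≈⟨ +P-cong (*P-distribˡ D (0F ∷ s) (k ∷ [])) (≋-refl {r}) ⟨
      (D *P ((0F ∷ s) +P (k ∷ []))) +P r               ∎
      where
      open SetoidReasoning ≋-setoid
      D*0∷s≋ : (D *P (0F ∷ s)) ≋ (0F ∷ (D *P s))
      D*0∷s≋ = ≋-trans (*P-∷ D 0F s) (+P-cong (scale-zeroˡ D) ≋-refl)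
      D*k≋ : (D *P (k ∷ [])) ≋ scale k D
      D*k≋ = ≋-trans (*P-∷ D k []) (≋-trans (+P-cong ≋-refl (≋-trans (∷-cong refl (*P-zeroʳ D)) 0∷[]≋[])) (+P-identityʳ _))
    r<m : DegreeBelow r m
    r<m = DegreeBelow-pred (DegreeBelow--P u<1+m (DegreeBelow-scale k (below D°m))) (begin
      coeff r m                                ≡⟨ coeff--P u (scale k D) m ⟩
      coeff u m +F (-F coeff (scale k D) m)    ≡⟨ cong (λ x → coeff u m +F (-F x)) (coeff-scale k D m) ⟩
      coeff u m +F (-F (k *F coeff D m))       ≡⟨ cong (λ x → coeff u m +F (-F x)) k*lc≡ ⟩
      coeff u m +F (-F coeff u m)              ≡⟨ 𝔽.-‿inverseʳ _ ⟩
      0F                                       ∎)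
      where
      open ≡-Reasoning
      u<1+m : DegreeBelow u (suc m)
      u<1+m = mkDegreeBelow λ { (suc i) (s≤s m≤i) → vanishes r′<m i m≤i }
      k*lc≡ : k *F coeff D m ≡ coeff u m
      k*lc≡ = trans (𝔽.*-assoc _ _ _) (trans (cong (coeff u m *F_) (trans (𝔽.*-comm lc⁻¹ _) lc*lc⁻¹≡1)) (𝔽.*-identityʳ _))

  ∣∧DegreeBelow⇒≋[] : ∀ {D m r} → HasDegree D m → D ∣ r → DegreeBelow r m → r ≋ []
  ∣∧DegreeBelow⇒≋[] {D} {m} D°m (divides w Dw≋r) r<m with ≋[]-or-HasDegree w
  ... | inj₁ w≋0       = ≋-trans (≋-sym Dw≋r) (≋-trans (*P-congʳ D w≋0) (*P-zeroʳ D))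
  ... | inj₂ (k , w°k) =
    ⊥-elim (leading≢0 (HasDegree-resp-≋ Dw≋r (HasDegree-*P D°m w°k)) (vanishes r<m (m + k) (ℕₚ.m≤m+n m k)))

  ∣-dec : ∀ {D m} → HasDegree D m → ∀ y → Dec (D ∣ y)
  ∣-dec {D} D°m y with mkDivMod s r y≋Ds+r r<m ← divMod D°m y with ≋[]-or-HasDegree r
  ... | inj₁ r≋0 = yes (divides s (≋-sym (≋-trans y≋Ds+r (≋-trans (+P-cong ≋-refl r≋0) (+P-identityʳ _)))))
  ... | inj₂ (_ , r°) = no λ D∣y →
    HasDegree⇒≉[] r° (∣∧DegreeBelow⇒≋[] D°m (∣-respʳ (≋-sym (≋+⇒≋- y≋Ds+r)) (∣g∣h⇒∣g-h D∣y (f∣f*g D s))) r<m)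

  ∣-DegreeBelow-unique : ∀ {D L y u v} → HasDegree D L → D ∣ (y -P u) → D ∣ (y -P v) →
                         DegreeBelow u L → DegreeBelow v L → u ≋ v
  ∣-DegreeBelow-unique {y = y} {u} {v} D°L D∣y-u D∣y-v u<L v<L = ℙₚ.x∙y⁻¹≈ε⇒x≈y u v
    (∣∧DegreeBelow⇒≋[] D°L (∣-respʳ ([y-v]-[y-u]≋u-v y u v) (∣g∣h⇒∣g-h D∣y-v D∣y-u)) (DegreeBelow--P u<L v<L))

  ∣-remainder : ∀ {D y g} b s r → y ≋ ((b *P s) +P r) → D ∣ (y *P g) → D ∣ (b *P g) → D ∣ (r *P g)
  ∣-remainder {D} {y} {g} b s r y≋bs+r D∣yg D∣bg = ∣-respʳ (≋-sym rg≋) (∣g∣h⇒∣g-h D∣yg (∣g⇒∣g*h s D∣bg))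
    where
    open SetoidReasoning ≋-setoid
    rg≋ : (r *P g) ≋ ((y *P g) -P ((b *P g) *P s))
    rg≋ = begin
      r *P g                          ≈⟨ *P-congˡ g (≋+⇒≋- y≋bs+r) ⟩
      (y -P (b *P s)) *P g            ≈⟨ ℙₚ.[y-z]x≈yx-zx g y (b *P s) ⟩
      (y *P g) -P ((b *P s) *P g)     ≈⟨ +P-cong (≋-refl {y *P g}) (negP-cong (*P-assoc b s g)) ⟩
      (y *P g) -P (b *P (s *P g))     ≈⟨ +P-cong (≋-refl {y *P g}) (negP-cong (*P-congʳ b (*P-comm s g))) ⟩
      (y *P g) -P (b *P (g *P s))     ≈⟨ +P-cong (≋-refl {y *P g}) (negP-cong (*P-assoc b g s)) ⟨
      (y *P g) -P ((b *P g) *P s)     ∎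

module Encoding (F : FiniteField) where
  open FiniteField F
  open Poly F
  open PolynomialRing F
  open Degrees F

  2≤card : 2 ≤ card
  2≤card = distinct⇒2≤ 0F 1F 0≢1
    where
    distinct⇒2≤ : ∀ {n} (a b : Fin n) → a ≢ b → 2 ≤ n
    distinct⇒2≤ {1}           Fin.zero Fin.zero a≢b = ⊥-elim (a≢b refl)
    distinct⇒2≤ {suc (suc n)} _        _        _   = s≤s (s≤s z≤n)

  -- Generic in the NonZero witness, since fromδ uses one that is private to Defs.
  δ-digits : ∀ {nz : NonZero card} k n → n ≤ k → δ (digits {{nz}} k n) ≡ n
  δ-digits         zero    zero    _         = refl
  δ-digits         (suc k) zero    _         = refl
  δ-digits {nz} (suc k) (suc n) (s≤s n≤k) = begin
    toℕ (fromℕ< (m%n<n (suc n) card)) + card * δ (digits k (suc n / card))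
      ≡⟨ cong₂ _+_ (Finₚ.toℕ-fromℕ< (m%n<n (suc n) card))
                   (cong (card *_) (δ-digits {nz} k (suc n / card) (ℕₚ.≤-trans (ℕₚ.≤-pred (m/n<m (suc n) card 2≤card)) n≤k))) ⟩
    suc n % card + card * (suc n / card)
      ≡⟨ cong (suc n % card +_) (ℕₚ.*-comm card _) ⟩
    suc n % card + (suc n / card) * card
      ≡⟨ m≡m%n+[m/n]*n (suc n) card ⟨
    suc n ∎
    where
    open ≡-Reasoning
    instance _ = nz

  instance
    card-nonZero : NonZero card
    card-nonZero = >-nonZero (ℕₚ.<-trans (s≤s z≤n) 2≤card)

  card^-nonZero : ∀ n → NonZero (card ^ n)
  card^-nonZero n = ℕₚ.m^n≢0 card n

  infixl 7 _/card^_
  _/card^_ : ℕ → ℕ → ℕ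
  m /card^ n = _/_ m (card ^ n) {{card^-nonZero n}}

  δ-fromδ : ∀ n → δ (fromδ n) ≡ n
  δ-fromδ n = δ-digits n n ℕₚ.≤-refl

  δ-≋[] : ∀ {f} → f ≋ [] → δ f ≡ 0
  δ-≋[] {[]}     _   = refl
  δ-≋[] {c ∷ cs} f≋0 with c≡0 , cs≋0 ← ∷≋[]-inverse f≋0 =
    trans (cong₂ (λ a b → a + card * b) (trans (cong toℕ c≡0) a₀≡0) (δ-≋[] cs≋0)) (ℕₚ.*-zeroʳ card)

  δ-resp-≋ : ∀ {f g} → f ≋ g → δ f ≡ δ g
  δ-resp-≋ {[]}     {g}      f≋g = sym (δ-≋[] (≋-sym f≋g))
  δ-resp-≋ {c ∷ cs} {[]}     f≋g = δ-≋[] f≋g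
  δ-resp-≋ {c ∷ cs} {d ∷ ds} f≋g with c≡d , cs≋ds ← ∷-injective f≋g =
    cong₂ (λ a b → toℕ a + card * b) c≡d (δ-resp-≋ cs≋ds)

  δ≡0⇒≋[] : ∀ {f} → δ f ≡ 0 → f ≋ []
  δ≡0⇒≋[] {[]}     _    = ≋-refl
  δ≡0⇒≋[] {c ∷ cs} δ≡0 =
    ≋-trans (∷-cong (Finₚ.toℕ-injective (trans (ℕₚ.m+n≡0⇒m≡0 (toℕ c) δ≡0) (sym a₀≡0)))
                    (δ≡0⇒≋[] (ℕₚ.m*n≡0⇒m≡0 _ _ (trans (ℕₚ.*-comm (δ cs) card) (ℕₚ.m+n≡0⇒n≡0 (toℕ c) δ≡0)))))
            0∷[]≋[]

  δ-injective : ∀ {f g} → δ f ≡ δ g → f ≋ g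
  δ-injective {[]}     {g}      δf≡δg = ≋-sym (δ≡0⇒≋[] (sym δf≡δg))
  δ-injective {c ∷ cs} {[]}     δf≡δg = δ≡0⇒≋[] δf≡δg
  δ-injective {c ∷ cs} {d ∷ ds} δf≡δg with c≡d , cs≡ds ← digit-injective (Finₚ.toℕ<n c) (Finₚ.toℕ<n d) δf≡δg =
    ∷-cong (Finₚ.toℕ-injective c≡d) (δ-injective cs≡ds)

  fromδ-δ : ∀ f → fromδ (δ f) ≋ f
  fromδ-δ f = δ-injective (δ-fromδ (δ f))

  fromδ-injective : ∀ {m n} → fromδ m ≋ fromδ n → m ≡ n
  fromδ-injective {m} {n} eq = trans (sym (δ-fromδ m)) (trans (δ-resp-≋ eq) (δ-fromδ n))

  DegreeBelow⇒δ< : ∀ {f} m → DegreeBelow f m → δ f < card ^ m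
  DegreeBelow⇒δ< {f}      zero    f<0   = s≤s (ℕₚ.≤-reflexive (δ-≋[] (DegreeBelow-0⇒≋[] f<0)))
  DegreeBelow⇒δ< {[]}     (suc m) _     = ℕₚ.m^n>0 card (suc m)
  DegreeBelow⇒δ< {c ∷ cs} (suc m) f<1+m = begin-strict
    toℕ c + card * δ cs   <⟨ ℕₚ.+-monoˡ-< (card * δ cs) (Finₚ.toℕ<n c) ⟩
    card + card * δ cs    ≡⟨ ℕₚ.*-suc card (δ cs) ⟨
    card * suc (δ cs)     ≤⟨ ℕₚ.*-monoʳ-≤ card (DegreeBelow⇒δ< m (∷-DegreeBelow f<1+m)) ⟩
    card * card ^ m       ∎
    where open ℕₚ.≤-Reasoning

  δ<⇒DegreeBelow : ∀ {f} m → δ f < card ^ m → DegreeBelow f m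
  δ<⇒DegreeBelow {f}      zero    δ<1 = ≋[]⇒DegreeBelow 0 (δ≡0⇒≋[] (ℕₚ.n<1⇒n≡0 δ<1))
  δ<⇒DegreeBelow {[]}     (suc m) _   = ≋[]⇒DegreeBelow (suc m) ≋-refl
  δ<⇒DegreeBelow {c ∷ cs} (suc m) δ<  = mkDegreeBelow λ { zero () ; (suc i) (s≤s m≤i) → vanishes cs<m i m≤i }
    where
    cs<m : DegreeBelow cs m
    cs<m = δ<⇒DegreeBelow m (ℕₚ.*-cancelˡ-< card (δ cs) (card ^ m) (ℕₚ.≤-<-trans (ℕₚ.m≤n+m (card * δ cs) (toℕ c)) δ<))

  HasDegree⇒card^≤δ : ∀ {f n} → HasDegree f n → card ^ n ≤ δ f
  HasDegree⇒card^≤δ {f} {n} f°n with δ f ℕₚ.<? card ^ n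
  ... | yes δ<  = ⊥-elim (ℕₚ.<-irrefl refl (HasDegree⇒< f°n (δ<⇒DegreeBelow n δ<)))
  ... | no  δ≮  = ℕₚ.≮⇒≥ δ≮

  shift : ℕ → Pol → Pol
  shift zero    f = f
  shift (suc m) f = 0F ∷ shift m f

  δ-shift : ∀ m f → δ (shift m f) ≡ card ^ m * δ f
  δ-shift zero    f = sym (ℕₚ.*-identityˡ (δ f))
  δ-shift (suc m) f = begin
    toℕ 0F + card * δ (shift m f)  ≡⟨ cong₂ _+_ a₀≡0 (cong (card *_) (δ-shift m f)) ⟩
    card * (card ^ m * δ f)        ≡⟨ ℕₚ.*-assoc card (card ^ m) (δ f) ⟨
    card ^ suc m * δ f             ∎
    where open ≡-Reasoning

  δ-shift-+P : ∀ {g} m f → DegreeBelow g m → δ (shift m f +P g) ≡ card ^ m * δ f + δ g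
  δ-shift-+P {g} zero f g<0 = begin
    δ (f +P g)             ≡⟨ δ-resp-≋ (≋-trans (+P-cong (≋-refl {f}) (DegreeBelow-0⇒≋[] g<0)) (+P-identityʳ f)) ⟩
    δ f                    ≡⟨ ℕₚ.*-identityˡ (δ f) ⟨
    1 * δ f                ≡⟨ ℕₚ.+-identityʳ _ ⟨
    1 * δ f + 0            ≡⟨ cong (1 * δ f +_) (δ-≋[] (DegreeBelow-0⇒≋[] g<0)) ⟨
    1 * δ f + δ g          ∎
    where open ≡-Reasoning
  δ-shift-+P {[]}     (suc m) f _ = trans (δ-shift (suc m) f) (sym (ℕₚ.+-identityʳ _))
  δ-shift-+P {c ∷ cs} (suc m) f c∷cs<1+m = begin
    toℕ (0F +F c) + card * δ (shift m f +P cs)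
      ≡⟨ cong₂ (λ a b → toℕ a + card * b) (𝔽.+-identityˡ c) (δ-shift-+P m f (∷-DegreeBelow c∷cs<1+m)) ⟩
    toℕ c + card * (card ^ m * δ f + δ cs)
      ≡⟨ solve 4 (λ c q x y → c :+ q :* (x :+ y) := q :* x :+ (c :+ q :* y)) refl (toℕ c) card (card ^ m * δ f) (δ cs) ⟩
    card * (card ^ m * δ f) + δ (c ∷ cs)
      ≡⟨ cong (_+ δ (c ∷ cs)) (ℕₚ.*-assoc card (card ^ m) (δ f)) ⟨
    card ^ suc m * δ f + δ (c ∷ cs)
      ∎
    where
    open ≡-Reasoning
    open +-*-Solver

  fromδ-+ : ∀ m b {i} → i < card ^ m → fromδ (b * card ^ m + i) ≋ (shift m (fromδ b) +P fromδ i)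
  fromδ-+ m b {i} i<q^m = δ-injective (begin
    δ (fromδ (b * card ^ m + i))
      ≡⟨ δ-fromδ _ ⟩
    b * card ^ m + i
      ≡⟨ cong₂ _+_ (trans (ℕₚ.*-comm b _) (cong (card ^ m *_) (sym (δ-fromδ b)))) (sym (δ-fromδ i)) ⟩
    card ^ m * δ (fromδ b) + δ (fromδ i)
      ≡⟨ δ-shift-+P m (fromδ b) (δ<⇒DegreeBelow m (subst (_< card ^ m) (sym (δ-fromδ i)) i<q^m)) ⟨
    δ (shift m (fromδ b) +P fromδ i)
      ∎)
    where open ≡-Reasoning

module CountingMultiples (F : FiniteField) where
  open FiniteField F
  open Poly F
  open PolynomialRing F
  open Degrees F
  open Division F
  open Encoding F

  module _ {D L} (D°L : HasDegree D L) (h : Pol) where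

    divides? : ∀ k → Dec (D ∣ (h -P fromδ k))
    divides? k = ∣-dec D°L (h -P fromδ k)

    open Counting divides?

    private
      Q = card ^ L
      instance
        Q-nonZero : NonZero Q
        Q-nonZero = card^-nonZero L

      fromδ<Q : ∀ {i} → i < Q → DegreeBelow (fromδ i) L
      fromδ<Q {i} i<Q = δ<⇒DegreeBelow L (subst (_< Q) (sym (δ-fromδ i)) i<Q)

      rebase : ∀ b {i} → i < Q → (h -P fromδ (b * Q + i)) ≋ ((h -P shift L (fromδ b)) -P fromδ i)
      rebase b i<Q = ≋-trans (+P-cong (≋-refl {h}) (negP-cong (fromδ-+ L b i<Q))) (y-[x+u]≋[y-x]-u h _ _)

      unique-in-block : ∀ b {i j} → i < Q → j < Q → D ∣ (h -P fromδ (b * Q + i)) → D ∣ (h -P fromδ (b * Q + j)) → i ≡ j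
      unique-in-block b i<Q j<Q D∣i D∣j = fromδ-injective
        (∣-DegreeBelow-unique D°L (∣-respʳ (rebase b i<Q) D∣i) (∣-respʳ (rebase b j<Q) D∣j) (fromδ<Q i<Q) (fromδ<Q j<Q))

      count-from : ℕ → ℕ → ℕ
      count-from b = Counting.count (λ i → divides? (b * Q + i))

      count-block : ∀ b → count-from b Q ≡ 1
      count-block b with mkDivMod s r y≋Ds+r r<L ← divMod D°L (h -P shift L (fromδ b)) =
        Counting.count-unique (λ i → divides? (b * Q + i)) Q δr<Q D∣δr (λ j j<Q D∣j → unique-in-block b j<Q δr<Q D∣j D∣δr)
        where
        δr<Q : δ r < Q
        δr<Q = DegreeBelow⇒δ< L r<L
        D∣δr : D ∣ (h -P fromδ (b * Q + δ r))
        D∣δr = ∣-respʳ (≋-sym (≋-trans (rebase b δr<Q) (+P-cong (≋-refl {h -P shift L (fromδ b)}) (negP-cong (fromδ-δ r)))))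
                       (divides s (≋+⇒≋- (≋-trans y≋Ds+r (+P-comm _ r))))

    count-divisible : count (δ h) ≡ δ h /card^ L
    count-divisible = begin
      count (δ h)                                               ≡⟨ cong count δh≡ ⟩
      count (b * Q + s)                                         ≡⟨ ∑<-+ _ (b * Q) s ⟩
      count (b * Q) + count-from b s                            ≡⟨ cong₂ _+_ (∑<-blocks _ b Q) last-block ⟩
      ∑< (λ c → count-from c Q) b + 0                           ≡⟨ ℕₚ.+-identityʳ _ ⟩
      ∑< (λ c → count-from c Q) b                               ≡⟨ ∑<-cong b (λ c _ → count-block c) ⟩
      ∑< (λ _ → 1) b                                            ≡⟨ trans (∑<-const 1 b) (ℕₚ.*-identityʳ b) ⟩
      b                                                         ∎
      where
      open ≡-Reasoning
      b = δ h / Q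
      s = δ h % Q
      s<Q = m%n<n (δ h) Q
      δh≡ : δ h ≡ b * Q + s
      δh≡ = trans (m≡m%n+[m/n]*n (δ h) Q) (ℕₚ.+-comm s (b * Q))
      D∣s : D ∣ (h -P fromδ (b * Q + s))
      D∣s = ∣-respʳ (≋-sym (≋-trans (+P-cong (≋-refl {h}) (negP-cong (subst (λ n → fromδ n ≋ h) δh≡ (fromδ-δ h)))) (+P-inverseʳ h)))
                    (divides [] (*P-zeroʳ D))
      last-block : count-from b s ≡ 0
      last-block = Counting.count-none (λ i → divides? (b * Q + i)) s
        λ i i<s D∣i → ℕₚ.<-irrefl (unique-in-block b (ℕₚ.<-trans i<s s<Q) s<Q D∣i D∣s) i<s

module Euclid (F : FiniteField) (P : Poly.Pol F) (P-irreducible : Poly.Irreducible F P) where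
  open FiniteField F
  open Poly F
  open PolynomialRing F
  open Degrees F
  open Division F

  d : ℕ
  d = deg P

  P°d : HasDegree P d
  P°d = 1≤deg⇒HasDegree (proj₁ P-irreducible)

  no-lowDegree-factor : ∀ {X s m} → P ≋ (X *P s) → HasDegree X m → 1 ≤ m → m < d → ⊥
  no-lowDegree-factor {X} {s} {m} P≋Xs X°m 1≤m m<d with proj₂ P-irreducible X s (≋⇒≈ P≋Xs)
  ... | inj₁ degX≡0 = ℕₚ.<⇒≢ 1≤m (sym (trans (sym (HasDegree⇒deg≡ X°m)) degX≡0))
  ... | inj₂ degs≡0 with ≋[]-or-HasDegree s
  ...   | inj₁ s≋0       = HasDegree⇒≉[] P°d (≋-trans P≋Xs (≋-trans (*P-congʳ X s≋0) (*P-zeroʳ X)))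
  ...   | inj₂ (k , s°k) with refl ← trans (sym (HasDegree⇒deg≡ s°k)) degs≡0 =
    ℕₚ.<⇒≢ m<d (trans (sym (ℕₚ.+-identityʳ m)) (HasDegree-unique (HasDegree-*P X°m s°k) (HasDegree-resp-≋ P≋Xs P°d)))

  -- Euclidean descent: X is replaced by the remainder of P modulo X.
  euclid-lowDegree : ∀ {X n g} → Acc _<_ n → HasDegree X n → n < d → P ∣ (X *P g) → P ∣ g
  euclid-lowDegree {X} {zero}  {g} _ X°0 _ P∣Xg with Z , ZX≋1 ← HasDegree-0⇒unit X°0 =
    ∣-respʳ (≋-trans (≋-sym (*P-assoc Z X g)) (≋-trans (*P-congˡ g ZX≋1) (*P-identityˡ g))) (∣g⇒∣h*g Z P∣Xg)
  euclid-lowDegree {X} {suc n} {g} (acc smaller) X°1+n 1+n<d P∣Xg with mkDivMod s r P≋Xs+r r<1+n ← divMod X°1+n P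
    with ≋[]-or-HasDegree r
  ... | inj₁ r≋0 = ⊥-elim (no-lowDegree-factor
                     (≋-trans P≋Xs+r (≋-trans (+P-cong (≋-refl {X *P s}) r≋0) (+P-identityʳ _))) X°1+n (s≤s z≤n) 1+n<d)
  ... | inj₂ (k , r°k) = euclid-lowDegree (smaller k<1+n) r°k (ℕₚ.<-trans k<1+n 1+n<d) (∣-remainder X s r P≋Xs+r (f∣f*g P g) P∣Xg)
    where k<1+n = HasDegree⇒< r°k r<1+n

  euclid : ∀ {f g} → P ∣ (f *P g) → ¬ P ∣ f → P ∣ g
  euclid {f} {g} P∣fg P∤f with mkDivMod s r f≋Ps+r r<d ← divMod P°d f with ≋[]-or-HasDegree r
  ... | inj₁ r≋0 = ⊥-elim (P∤f (divides s (≋-sym (≋-trans f≋Ps+r (≋-trans (+P-cong (≋-refl {P *P s}) r≋0) (+P-identityʳ _))))))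
  ... | inj₂ (k , r°k) = euclid-lowDegree (<-wellFounded k) r°k (HasDegree⇒< r°k r<d) (∣-remainder P s r f≋Ps+r P∣fg (f∣f*g P g))

module Valuations (F : FiniteField) (P : Poly.Pol F) (P-irreducible : Poly.Irreducible F P) where
  open FiniteField F
  open Poly F
  open PolynomialRing F
  open Degrees F
  open Division F
  open Encoding F
  open Euclid F P P-irreducible public

  private
    d-nonZero : NonZero d
    d-nonZero = >-nonZero (proj₁ P-irreducible)

  record Valuation (f : Pol) (v : ℕ) : Set where
    constructor mkValuation
    field ^P-∣ : (P ^P v) ∣ f
          ^P-∤ : ¬ (P ^P suc v) ∣ f
  open Valuation public

  ^P-+ : ∀ a b → (P ^P (a + b)) ≋ ((P ^P a) *P (P ^P b))
  ^P-+ zero    b = ≋-sym (*P-identityˡ (P ^P b))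
  ^P-+ (suc a) b = ≋-trans (*P-congʳ P (^P-+ a b)) (≋-sym (*P-assoc P (P ^P a) (P ^P b)))

  ^P-∣-mono : ∀ {a b} → a ≤ b → (P ^P a) ∣ (P ^P b)
  ^P-∣-mono {a} {b} a≤b = subst (λ n → (P ^P a) ∣ (P ^P n)) (ℕₚ.m+[n∸m]≡n a≤b) (divides (P ^P (b ∸ a)) (≋-sym (^P-+ a (b ∸ a))))

  ≤-Valuation⇒^P∣ : ∀ {f v e} → Valuation f v → e ≤ v → (P ^P e) ∣ f
  ≤-Valuation⇒^P∣ f°v e≤v = ∣-trans (^P-∣-mono e≤v) (^P-∣ f°v)

  ^P∣⇒≤-Valuation : ∀ {f v e} → Valuation f v → (P ^P e) ∣ f → e ≤ v
  ^P∣⇒≤-Valuation {e = e} f°v P^e∣f with e ℕₚ.≤? _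
  ... | yes e≤v = e≤v
  ... | no  e≰v = ⊥-elim (^P-∤ f°v (∣-trans (^P-∣-mono (ℕₚ.≰⇒> e≰v)) P^e∣f))

  Valuation⇒cofactor : ∀ {f v} → Valuation f v → ∃ λ f′ → ((P ^P v) *P f′) ≋ f × ¬ P ∣ f′
  Valuation⇒cofactor {f} {v} (mkValuation (divides f′ P^vf′≋f) P^1+v∤f) = f′ , P^vf′≋f , P∤f′
    where
    open SetoidReasoning ≋-setoid
    P∤f′ : ¬ P ∣ f′
    P∤f′ (divides w Pw≋f′) = P^1+v∤f (divides w (begin
      (P *P (P ^P v)) *P w   ≈⟨ *P-congˡ w (*P-comm P (P ^P v)) ⟩
      ((P ^P v) *P P) *P w   ≈⟨ *P-assoc (P ^P v) P w ⟩
      (P ^P v) *P (P *P w)   ≈⟨ *P-congʳ (P ^P v) Pw≋f′ ⟩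
      (P ^P v) *P f′         ≈⟨ P^vf′≋f ⟩
      f                      ∎))

  Valuation-*P : ∀ {f g a b} → Valuation f a → Valuation g b → Valuation (f *P g) (a + b)
  Valuation-*P {f} {g} {a} {b} f°a g°b with f′ , P^af′≋f , P∤f′ ← Valuation⇒cofactor f°a
                                           | g′ , P^bg′≋g , P∤g′ ← Valuation⇒cofactor g°b =
    mkValuation (divides (f′ *P g′) P^[a+b]f′g′≋fg) P^[1+a+b]∤fg
    where
    open SetoidReasoning ≋-setoid
    open CommSemigroupProperties ℙ.*-commutativeSemigroup using (interchange)
    P^[a+b]f′g′≋fg : ((P ^P (a + b)) *P (f′ *P g′)) ≋ (f *P g)
    P^[a+b]f′g′≋fg = begin
      (P ^P (a + b)) *P (f′ *P g′)           ≈⟨ *P-congˡ (f′ *P g′) (^P-+ a b) ⟩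
      ((P ^P a) *P (P ^P b)) *P (f′ *P g′)   ≈⟨ interchange (P ^P a) (P ^P b) f′ g′ ⟩
      ((P ^P a) *P f′) *P ((P ^P b) *P g′)   ≈⟨ *P-cong P^af′≋f P^bg′≋g ⟩
      f *P g                                 ∎
    P^[1+a+b]∤fg : ¬ (P ^P suc (a + b)) ∣ (f *P g)
    P^[1+a+b]∤fg (divides w P^[1+a+b]w≋fg) = P∤g′ (euclid (divides w Pw≋f′g′) P∤f′)
      where
      Pw≋f′g′ : (P *P w) ≋ (f′ *P g′)
      Pw≋f′g′ = *P-cancelˡ (HasDegree⇒≉[] (HasDegree-^P P°d (a + b))) (begin
        (P ^P (a + b)) *P (P *P w)     ≈⟨ *P-assoc (P ^P (a + b)) P w ⟨
        ((P ^P (a + b)) *P P) *P w     ≈⟨ *P-congˡ w (*P-comm (P ^P (a + b)) P) ⟩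
        (P ^P suc (a + b)) *P w        ≈⟨ P^[1+a+b]w≋fg ⟩
        f *P g                         ≈⟨ P^[a+b]f′g′≋fg ⟨
        (P ^P (a + b)) *P (f′ *P g′)   ∎)

  Valuation-1P : Valuation 1P 0
  Valuation-1P = mkValuation ∣-refl λ P*1∣1 →
    0≢1 (sym (coeff-≡ (∣∧DegreeBelow⇒≋[] P°d (∣-trans (f∣f*g P 1P) P*1∣1) 1<d) 0))
    where
    1<d : DegreeBelow 1P d
    1<d = mkDegreeBelow λ { zero d≤0 → ⊥-elim (ℕₚ.<⇒≱ (proj₁ P-irreducible) d≤0) ; (suc i) _ → refl }

  Valuation-prodP : ∀ (G : ℕ → Pol) (v : ℕ → ℕ) n → (∀ k → k < n → Valuation (G k) (v k)) →
                    Valuation (prodP (applyUpTo G n)) (∑< v n)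
  Valuation-prodP G v zero    _   = Valuation-1P
  Valuation-prodP G v (suc n) G°v = subst (Valuation _) (sym (∑<-suc v n))
    (Valuation-*P (G°v 0 (s≤s z≤n)) (Valuation-prodP (λ k → G (suc k)) (λ k → v (suc k)) n (λ k k<n → G°v (suc k) (s≤s k<n))))

  ^P-∣? : ∀ j f → Dec ((P ^P j) ∣ f)
  ^P-∣? j = ∣-dec (HasDegree-^P P°d j)

  Valuation-count : ∀ f n → ¬ (P ^P suc n) ∣ f → Valuation f (Counting.count (λ j → ^P-∣? (suc j) f) n)
  Valuation-count f zero    P∤f = mkValuation (divides f (*P-identityˡ f)) P∤f
  Valuation-count f (suc n) P^2+n∤f with ^P-∣? (suc n) f
  ... | no  P^1+n∤f = subst (Valuation f) (sym (ℕₚ.+-identityʳ _)) (Valuation-count f n P^1+n∤f)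
  ... | yes P^1+n∣f = subst (Valuation f) (sym (trans (cong (_+ 1) all-below) (ℕₚ.+-comm n 1))) (mkValuation P^1+n∣f P^2+n∤f)
    where
    all-below : Counting.count (λ j → ^P-∣? (suc j) f) n ≡ n
    all-below = Counting.count-all (λ j → ^P-∣? (suc j) f) n (λ j j<n → ∣-trans (^P-∣-mono (ℕₚ.<⇒≤ (s≤s j<n))) P^1+n∣f)

  -- The terms of the Legendre sum with j ≥ M vanish, since M < q ^ ((j + 1) · deg P).
  legendre : ℕ → ℕ
  legendre M = ∑< (λ j → M /card^ (suc j * d)) M

  Valuation-! : ∀ h → Valuation (h !) (legendre (δ h))
  Valuation-! h = subst₂ Valuation (cong prodP (sym (map-upTo G M))) v-total
                    (Valuation-prodP G v M (λ k k<M → Valuation-count (G k) M (P^1+M∤G k k<M)))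
    where
    M = δ h
    G : ℕ → Pol
    G k = h -P fromδ k
    v : ℕ → ℕ
    v k = Counting.count (λ j → ^P-∣? (suc j) (G k)) M
    open CountingMultiples F
    P^1+M∤G : ∀ k → k < M → ¬ (P ^P suc M) ∣ G k
    P^1+M∤G = Counting.count≡0⇒none (divides? (HasDegree-^P P°d (suc M)) h) M
      (trans (count-divisible (HasDegree-^P P°d (suc M)) h) (m<n⇒m/n≡0 {{card^-nonZero (suc M * d)}} M<card^))
      where
      M<card^ : M < card ^ (suc M * d)
      M<card^ = ℕₚ.<-≤-trans (n<m^n M 2≤card) (ℕₚ.^-monoʳ-≤ card (ℕₚ.≤-trans (ℕₚ.n≤1+n M) (ℕₚ.m≤m*n (suc M) d {{d-nonZero}})))
    v-total : ∑< v M ≡ legendre M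
    v-total = trans (∑<-comm (λ k j → indicator (^P-∣? (suc j) (G k))) M M)
                    (∑<-cong M (λ j _ → count-divisible (HasDegree-^P P°d (suc j)) h))

module SmarandacheBound (F : FiniteField) (P : Poly.Pol F) (P-irreducible : Poly.Irreducible F P) (e : ℕ) where
  open FiniteField F
  open Poly F
  open PolynomialRing F
  open Degrees F
  open Division F
  open Encoding F
  open Valuations F P P-irreducible public

  ^P∣!⇒≤legendre : ∀ h → (P ^P e) ∣P (h !) → e ≤ legendre (δ h)
  ^P∣!⇒≤legendre h P^e∣h! = ^P∣⇒≤-Valuation (Valuation-! h) (∣P⇒∣ P^e∣h!)

  ≤legendre⇒^P∣! : ∀ h → e ≤ legendre (δ h) → (P ^P e) ∣P (h !)
  ≤legendre⇒^P∣! h e≤ = ∣⇒∣P (≤-Valuation⇒^P∣ (Valuation-! h) e≤)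

  IsS-fromδ-least : ∀ {N} → e ≤ legendre N → (∀ M → M < N → ¬ e ≤ legendre M) → IsS (P ^P e) (fromδ N)
  IsS-fromδ-least {N} e≤ℓN below-N =
    ≤legendre⇒^P∣! (fromδ N) (subst (λ n → e ≤ legendre n) (sym (δ-fromδ N)) e≤ℓN) ,
    λ h δh<δg P^e∣h! → below-N (δ h) (subst (δ h <_) (δ-fromδ N) δh<δg) (^P∣!⇒≤legendre h P^e∣h!)

  ≤legendre[e*card^d] : 1 ≤ e → e ≤ legendre (e * card ^ d)
  ≤legendre[e*card^d] 1≤e = begin
    e                            ≡⟨ m*n/n≡m e Q ⟨
    e * Q /card^ d               ≡⟨ cong (e * Q /card^_) (ℕₚ.*-identityˡ d) ⟨
    e * Q /card^ (1 * d)         ≤⟨ f0≤∑< (λ j → e * Q /card^ (suc j * d)) (ℕₚ.*-mono-≤ 1≤e (ℕₚ.m^n>0 card d)) ⟩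
    legendre (e * Q)             ∎
    where
    open ℕₚ.≤-Reasoning
    Q = card ^ d
    instance _ = card^-nonZero d

  IsS-exists : 1 ≤ e → ∃ λ g → IsS (P ^P e) g × δ g ≤ e * card ^ d
  IsS-exists 1≤e with N , N≤ , e≤ℓN , below-N ← Counting.least (λ M → e ℕₚ.≤? legendre M) (e * card ^ d) (≤legendre[e*card^d] 1≤e) =
    fromδ N , IsS-fromδ-least e≤ℓN below-N , subst (_≤ e * card ^ d) (sym (δ-fromδ N)) N≤

  *card^d<δ[P^e] : ∀ {N} → 2 ≤ d → 3 ≤ e → N ≤ e * card ^ d → N * card ^ d < δ (P ^P e)
  *card^d<δ[P^e] {N} 2≤d 3≤e N≤ = begin-strict
    N * Q              ≤⟨ ℕₚ.*-monoˡ-≤ Q N≤ ⟩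
    e * Q * Q          ≡⟨ ℕₚ.*-assoc e Q Q ⟩
    e * (Q * Q)        <⟨ m*n²<n^m 3≤e 4≤Q ⟩
    Q ^ e              ≡⟨ trans (ℕₚ.^-*-assoc card d e) (cong (card ^_) (ℕₚ.*-comm d e)) ⟩
    card ^ (e * d)     ≤⟨ HasDegree⇒card^≤δ (HasDegree-^P P°d e) ⟩
    δ (P ^P e)         ∎
    where
    open ℕₚ.≤-Reasoning
    Q = card ^ d
    4≤Q : 4 ≤ Q
    4≤Q = ℕₚ.≤-trans (ℕₚ.^-monoˡ-≤ 2 2≤card) (ℕₚ.^-monoʳ-≤ card 2≤d)

corollary3p7 : (F : FiniteField) → let open Poly F in
    ∀ (P : Pol) → Irreducible P → 2 ≤ deg P → ∀ (e : ℕ) → 3 ≤ e →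
    ∃ λ g → IsS (P ^P e) g × (δ g * card ^ deg P < δ (P ^P e))
corollary3p7 F P P-irreducible 2≤d e 3≤e =
  let open SmarandacheBound F P P-irreducible e
      (g , g-IsS , δg≤e*card^d) = IsS-exists (ℕₚ.≤-trans (s≤s z≤n) 3≤e)
  in g , g-IsS , *card^d<δ[P^e] 2≤d 3≤e δg≤e*card^d
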